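{- Let $F_1$ be a set of singletons $\{x\}$ with $x\in V(BH_2)$ and let $F_2$ be a set of pairs $\{x_1,x_2\}$ with $x_1x_2\in E(BH_2)$. If $|F_1|+|F_2|\leq 3$, then $BH_2-V(F_1\cup F_2)$ is connected.
   Context: The $n$-dimensional balanced hypercube $BH_n$ is the graph with vertex set $\{0,1,2,3\}^n$, vertices written $(a_0,a_1,\dots,a_{n-1})$, in which $(a_0,\dots,a_{n-1})$ is adjacent exactly to the $2n$ vertices $((a_0\pm 1)\bmod 4,a_1,\dots,a_{n-1})$ and, for each $1\le i\le n-1$, $((a_0\pm1)\bmod 4,a_1,\dots,a_{i-1},(a_i+(-1)^{a_0})\bmod 4,a_{i+1},\dots,a_{n-1})$. Here $n=2$. $V(F_1\cup F_2)$ denotes the union of all the sets in $F_1\cup F_2$. -}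

module Defs where

open import Data.Fin using (Fin; zero; suc)
open import Data.Product using (_×_; _,_; proj₁; proj₂; Σ)
open import Data.Sum using (_⊎_)
open import Data.List using (List)
open import Data.List.Membership.Propositional using (_∈_)
open import Data.List.Relation.Unary.Any using (Any)
open import Relation.Binary.PropositionalEquality using (_≡_)
open import Relation.Nullary using (¬_)

Vertex : Set
Vertex = Fin 4 × Fin 4

inc : Fin 4 → Fin 4
inc zero = suc zero
inc (suc zero) = suc (suc zero)
inc (suc (suc zero)) = suc (suc (suc zero))
inc (suc (suc (suc zero))) = zero

dec : Fin 4 → Fin 4
dec zero = suc (suc (suc zero))
dec (suc zero) = zero
dec (suc (suc zero)) = suc zero
dec (suc (suc (suc zero))) = suc (suc zero)

-- b ↦ (b + (-1)^a) mod 4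
shift : Fin 4 → Fin 4 → Fin 4
shift zero b = inc b
shift (suc zero) b = dec b
shift (suc (suc zero)) b = inc b
shift (suc (suc (suc zero))) b = dec b

data Adj : Vertex → Vertex → Set where
  inner-inc : ∀ {a b} → Adj (a , b) (inc a , b)
  inner-dec : ∀ {a b} → Adj (a , b) (dec a , b)
  outer-inc : ∀ {a b} → Adj (a , b) (inc a , shift a b)
  outer-dec : ∀ {a b} → Adj (a , b) (dec a , shift a b)

Edge : Set
Edge = Σ (Vertex × Vertex) (λ p → Adj (proj₁ p) (proj₂ p))

-- x ∈ V(F₁ ∪ F₂), with F₁ given by the list of its singleton elements
Removed : List Vertex → List Edge → Vertex → Set
Removed F₁ F₂ x =
  x ∈ F₁ ⊎ Any (λ e → x ≡ proj₁ (proj₁ e) ⊎ x ≡ proj₂ (proj₁ e)) F₂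

data Walk (P : Vertex → Set) : Vertex → Vertex → Set where
  here : ∀ {u} → P u → Walk P u u
  step : ∀ {u w v} → P u → Adj u w → Walk P w v → Walk P u v

Connected : (Vertex → Set) → Set
Connected P = ∀ u v → P u → P v → Walk P u v

Remaining : List Vertex → List Edge → Vertex → Set
Remaining F₁ F₂ x = ¬ Removed F₁ F₂ x

module Submission where

-- In BH₂ the vertices (a , b) and (a + 2 , b) have the same
-- neighbourhood, and the sixteen vertices fall into eight such twin classes.
-- The classes, numbered around a cycle, form the 8-cycle C₈, and BH₂ is C₈
-- with every vertex blown up into two non-adjacent twins: two vertices are
-- adjacent exactly when their classes are adjacent on the cycle.
--
-- Call a class dead when both of its members are deleted.  A deleted block
-- (a vertex or an edge) can meet at most one vertex of an independent set, so
-- two dead classes that are neither equal nor cycle-adjacent would give four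
-- independent deleted vertices, hence at least four blocks.  With at most three
-- blocks all dead classes are therefore pairwise "near".  Finally, between any
-- two classes of C₈ there are two arcs lying far apart from each other, so a
-- pairwise-near set of dead classes misses one of them entirely; a live path of
-- classes lifts to a walk between any two live vertices.

open import Defs
open import Data.Nat using (_+_; _*_; _≤_)
open import Data.Nat.Properties using (≤-trans; n≮n)
open import Data.Fin using (Fin; _≟_)
open import Data.Fin.Base using (remQuot; combine)
open import Data.Fin.Patterns using (0F; 1F; 2F; 3F; 4F; 5F; 6F; 7F)
open import Data.Fin.Properties using (all?; injective⇒≤; combine-remQuot)
open import Data.List using (List; []; _∷_; [_]; length; lookup; map; _++_; iterate; takeWhile; reverse)
open import Data.List.Properties using (length-++; length-map)
open import Data.List.Relation.Unary.All as All using (All; []; _∷_; lookupWith)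
open import Data.List.Relation.Unary.Any as Any using (Any; here; there; any?)
open import Data.List.Relation.Unary.Any.Properties using (lookup-index; map⁺; ++⁺ˡ; ++⁺ʳ)
open import Data.Product using (∃-syntax; _×_; _,_; proj₁; proj₂; uncurry)
open import Data.Product.Properties using (≡-dec; ,-injectiveˡ; ,-injectiveʳ)
open import Data.Sum using (_⊎_; inj₁; inj₂; swap) renaming (map to ⊎-map)
open import Data.Empty using (⊥; ⊥-elim)
open import Function using (_∘_)
open import Relation.Nullary using (¬_; Dec; yes; no; ¬?; contradiction)
open import Relation.Nullary.Decidable using (from-yes; decidable-stable; map′; _⊎-dec_; _×-dec_; _→-dec_)
open import Relation.Unary using (Decidable)
open import Relation.Binary.PropositionalEquality using (_≡_; _≢_; refl; sym; trans; cong; cong₂; subst; subst₂; module ≡-Reasoning)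

_≟V_ : (x y : Vertex) → Dec (x ≡ y)
_≟V_ = ≡-dec _≟_ _≟_

all-vertices? : {P : Vertex → Set} → Decidable P → Dec (∀ x → P x)
all-vertices? P? = map′ (λ h x → h (proj₁ x) (proj₂ x)) (λ h a b → h (a , b))
                        (all? λ a → all? λ b → P? (a , b))

adj? : ∀ x y → Dec (Adj x y)
adj? (a , b) y = map′ neighbour inversion
  (y ≟V (inc a , b) ⊎-dec y ≟V (dec a , b) ⊎-dec
   y ≟V (inc a , shift a b) ⊎-dec y ≟V (dec a , shift a b))
  where
  neighbour : y ≡ (inc a , b) ⊎ y ≡ (dec a , b) ⊎ y ≡ (inc a , shift a b) ⊎ y ≡ (dec a , shift a b) →
              Adj (a , b) y
  neighbour (inj₁ refl)               = inner-inc
  neighbour (inj₂ (inj₁ refl))        = inner-dec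
  neighbour (inj₂ (inj₂ (inj₁ refl))) = outer-inc
  neighbour (inj₂ (inj₂ (inj₂ refl))) = outer-dec
  inversion : Adj (a , b) y →
              y ≡ (inc a , b) ⊎ y ≡ (dec a , b) ⊎ y ≡ (inc a , shift a b) ⊎ y ≡ (dec a , shift a b)
  inversion inner-inc = inj₁ refl
  inversion inner-dec = inj₂ (inj₁ refl)
  inversion outer-inc = inj₂ (inj₂ (inj₁ refl))
  inversion outer-dec = inj₂ (inj₂ (inj₂ refl))

-- Twin classes.  Class c consists of representative c and its twin
-- (a + 2 , b); the classes are numbered in their cyclic order.

twin : Vertex → Vertex
twin (a , b) = inc (inc a) , b

representative : Fin 8 → Vertex
representative 0F = 0F , 0F
representative 1F = 1F , 1F
representative 2F = 0F , 1F
representative 3F = 1F , 2F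
representative 4F = 0F , 2F
representative 5F = 1F , 3F
representative 6F = 0F , 3F
representative 7F = 1F , 0F

member : Fin 8 → Fin 2 → Vertex
member c 0F = representative c
member c 1F = twin (representative c)

classOf : Vertex → Fin 8
classOf (a , b) = position (parity a) b
  where
  parity : Fin 4 → Fin 2
  parity 0F = 0F
  parity 1F = 1F
  parity 2F = 0F
  parity 3F = 1F
  position : Fin 2 → Fin 4 → Fin 8
  position 0F 0F = 0F
  position 0F 1F = 2F
  position 0F 2F = 4F
  position 0F 3F = 6F
  position 1F 0F = 7F
  position 1F 1F = 1F
  position 1F 2F = 3F
  position 1F 3F = 5F

sideOf : Vertex → Fin 2
sideOf (0F , _) = 0F
sideOf (1F , _) = 0F
sideOf (2F , _) = 1F
sideOf (3F , _) = 1F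

member-classOf : ∀ x → member (classOf x) (sideOf x) ≡ x
member-classOf = from-yes (all-vertices? λ x → member (classOf x) (sideOf x) ≟V x)

classOf-member : ∀ c s → classOf (member c s) ≡ c
classOf-member = from-yes (all? λ c → all? λ s → classOf (member c s) ≟ c)

sideOf-member : ∀ c s → sideOf (member c s) ≡ s
sideOf-member = from-yes (all? λ c → all? λ s → sideOf (member c s) ≟ s)

member-injective : ∀ {c d s t} → member c s ≡ member d t → c ≡ d × s ≡ t
member-injective {c} {d} {s} {t} e =
    trans (sym (classOf-member c s)) (trans (cong classOf e) (classOf-member d t))
  , trans (sym (sideOf-member c s)) (trans (cong sideOf e) (sideOf-member d t))

next : Fin 8 → Fin 8
next 0F = 1F
next 1F = 2F
next 2F = 3F
next 3F = 4F
next 4F = 5F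
next 5F = 6F
next 6F = 7F
next 7F = 0F

prev : Fin 8 → Fin 8
prev 0F = 7F
prev 1F = 0F
prev 2F = 1F
prev 3F = 2F
prev 4F = 3F
prev 5F = 4F
prev 6F = 5F
prev 7F = 6F

_~_ : Fin 8 → Fin 8 → Set
c ~ d = d ≡ next c ⊎ c ≡ next d

_~?_ : ∀ c d → Dec (c ~ d)
c ~? d = d ≟ next c ⊎-dec c ≟ next d

~-sym : ∀ {c d} → c ~ d → d ~ c
~-sym = swap

~-irrefl : ∀ c → ¬ c ~ c
~-irrefl = from-yes (all? λ c → ¬? (c ~? c))

Near : Fin 8 → Fin 8 → Set
Near c d = c ≡ d ⊎ c ~ d

Near? : ∀ c d → Dec (Near c d)
Near? c d = c ≟ d ⊎-dec c ~? d

Near-sym : ∀ {c d} → Near c d → Near d c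
Near-sym = ⊎-map sym ~-sym

adjacent-classes : ∀ {x y} → Adj x y → classOf x ~ classOf y
adjacent-classes {x} {y} = from-yes
  (all-vertices? λ x → all-vertices? λ y → adj? x y →-dec classOf x ~? classOf y) x y

classes-adjacent : ∀ {c d} → c ~ d → ∀ s t → Adj (member c s) (member d t)
classes-adjacent {c} {d} = from-yes
  (all? λ c → all? λ d → c ~? d →-dec all? λ s → all? λ t → adj? (member c s) (member d t)) c d

Chain : Fin 8 → List (Fin 8) → Fin 8 → Set
Chain i []       k = i ~ k
Chain i (c ∷ cs) k = i ~ c × Chain c cs k

Chain? : ∀ i cs k → Dec (Chain i cs k)
Chain? i []       k = i ~? k
Chain? i (c ∷ cs) k = i ~? c ×-dec Chain? c cs k

-- The classes strictly between i and k, walking forward around the cycle.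
forward : Fin 8 → Fin 8 → List (Fin 8)
forward i k = takeWhile (λ c → ¬? (c ≟ k)) (iterate next (next i) 7)

-- Interiors of two paths from i to k: the two arcs of the cycle, or for
-- i = k the detours through the two neighbours of i.
arcs : Fin 8 → Fin 8 → List (Fin 8) × List (Fin 8)
arcs i k with i ≟ k
... | yes _ = [ next i ] , [ prev i ]
... | no _  = forward i k , reverse (forward k i)

Separated : List (Fin 8) → List (Fin 8) → Set
Separated L M = All (λ c → All (λ d → ¬ Near c d) M) L

Separated? : ∀ L M → Dec (Separated L M)
Separated? L M = All.all? (λ c → All.all? (λ d → ¬? (Near? c d)) M) L

ArcsValid : Fin 8 → Fin 8 → Set
ArcsValid i k = let (L , M) = arcs i k in Chain i L k × Chain i M k × Separated L M

arcs-valid : ∀ i k → ArcsValid i k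
arcs-valid = from-yes (all? λ i → all? λ k → let (L , M) = arcs i k in
  Chain? i L k ×-dec Chain? i M k ×-dec Separated? L M)

all-or-any : {X : Set} {A B : X → Set} → (∀ x → A x ⊎ B x) → ∀ xs → All A xs ⊎ Any B xs
all-or-any split []       = inj₁ []
all-or-any split (x ∷ xs) with split x | all-or-any split xs
... | inj₂ b | _        = inj₂ (here b)
... | inj₁ a | inj₁ as  = inj₁ (a ∷ as)
... | inj₁ _ | inj₂ bs  = inj₂ (there bs)

module Criterion (P : Vertex → Set) (P? : Decidable P) where

  Alive : Fin 8 → Set
  Alive c = ∃[ s ] P (member c s)

  Dead : Fin 8 → Set
  Dead c = ∀ s → ¬ P (member c s)

  alive-or-dead : ∀ c → Alive c ⊎ Dead c
  alive-or-dead c with P? (member c 0F) | P? (member c 1F)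
  ... | yes p | _     = inj₁ (0F , p)
  ... | no _  | yes q = inj₁ (1F , q)
  ... | no p  | no q  = inj₂ λ { 0F → p ; 1F → q }

  lift-chain : ∀ i cs k → Chain i cs k → All Alive cs →
               ∀ s t → P (member i s) → P (member k t) → Walk P (member i s) (member k t)
  lift-chain i []       k i~k          []              s t pu pv =
    step pu (classes-adjacent i~k s t) (here pv)
  lift-chain i (c ∷ cs) k (i~c , rest) ((r , pc) ∷ al) s t pu pv =
    step pu (classes-adjacent i~c s r) (lift-chain c cs k rest al r t pc pv)

  DeadNear : Set
  DeadNear = ∀ c d → Dead c → Dead d → Near c d

  not-both-dead : DeadNear → ∀ L M → Separated L M → Any Dead L → Any Dead M → ⊥
  not-both-dead near L M sep deadL deadM =
    lookupWith (λ far-c dead-c → lookupWith (λ far dead-d → far (near _ _ dead-c dead-d)) far-c deadM)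
               sep deadL

  -- The criterion: route through whichever of the two arcs has no dead class.
  connected : DeadNear → Connected P
  connected near u v pu pv =
    subst₂ (Walk P) (member-classOf u) (member-classOf v)
      (route (classOf u) (classOf v) (sideOf u) (sideOf v) (in-class u pu) (in-class v pv))
    where
    in-class : ∀ x → P x → P (member (classOf x) (sideOf x))
    in-class x = subst P (sym (member-classOf x))
    route : ∀ i k s t → P (member i s) → P (member k t) → Walk P (member i s) (member k t)
    route i k s t pu pv = via (arcs-valid i k)
      where
      via : ArcsValid i k → Walk P (member i s) (member k t)
      via (chain₁ , chain₂ , sep)
        with all-or-any alive-or-dead (proj₁ (arcs i k)) | all-or-any alive-or-dead (proj₂ (arcs i k))
      ... | inj₁ alive₁ | _           = lift-chain i _ k chain₁ alive₁ s t pu pv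
      ... | inj₂ _      | inj₁ alive₂ = lift-chain i _ k chain₂ alive₂ s t pu pv
      ... | inj₂ dead₁  | inj₂ dead₂  = ⊥-elim (not-both-dead near _ _ sep dead₁ dead₂)

Apart : Vertex → Vertex → Set
Apart x y = x ≢ y × ¬ Adj x y × ¬ Adj y x

module Blocks (F₁ : List Vertex) (F₂ : List Edge) where

  Block : Set
  Block = Vertex ⊎ Edge

  covers : Block → Vertex → Set
  covers (inj₁ v) x = x ≡ v
  covers (inj₂ e) x = x ≡ proj₁ (proj₁ e) ⊎ x ≡ proj₂ (proj₁ e)

  blocks : List Block
  blocks = map inj₁ F₁ ++ map inj₂ F₂

  blocks-length : length blocks ≡ length F₁ + length F₂
  blocks-length = trans (length-++ (map inj₁ F₁))
                        (cong₂ _+_ (length-map inj₁ F₁) (length-map inj₂ F₂))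

  block-of : ∀ {x} → Removed F₁ F₂ x → Any (λ b → covers b x) blocks
  block-of (inj₁ x∈F₁) = ++⁺ˡ (map⁺ x∈F₁)
  block-of (inj₂ x∈F₂) = ++⁺ʳ (map inj₁ F₁) (map⁺ x∈F₂)

  covers-not-apart : ∀ b {x y} → covers b x → covers b y → ¬ Apart x y
  covers-not-apart (inj₁ _) refl refl (x≢y , _) = x≢y refl
  covers-not-apart (inj₂ (_ , xy)) (inj₁ refl) (inj₁ refl) (x≢y , _)     = x≢y refl
  covers-not-apart (inj₂ (_ , xy)) (inj₁ refl) (inj₂ refl) (_ , ¬xy , _) = ¬xy xy
  covers-not-apart (inj₂ (_ , yx)) (inj₂ refl) (inj₁ refl) (_ , _ , ¬yx) = ¬yx yx
  covers-not-apart (inj₂ (_ , xy)) (inj₂ refl) (inj₂ refl) (x≢y , _)     = x≢y refl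

  -- Deleting k pairwise apart vertices requires at least k blocks: sending each
  -- vertex to a block covering it is injective.
  independent-bound : ∀ {k} (f : Fin k → Vertex) → (∀ i j → i ≢ j → Apart (f i) (f j)) →
                      (∀ i → Removed F₁ F₂ (f i)) → k ≤ length F₁ + length F₂
  independent-bound f apart removed =
    subst (_ ≤_) blocks-length (injective⇒≤ {f = index} index-injective)
    where
    index : _ → Fin (length blocks)
    index i = Any.index (block-of (removed i))
    index-injective : ∀ {i j} → index i ≡ index j → i ≡ j
    index-injective {i} {j} same with i ≟ j
    ... | yes i≡j = i≡j
    ... | no  i≢j = ⊥-elim (covers-not-apart (lookup blocks (index i))
                              (lookup-index (block-of (removed i)))
                              (subst (λ n → covers (lookup blocks n) (f j)) (sym same)
                                     (lookup-index (block-of (removed j))))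
                              (apart i j i≢j))

members-adjacent : ∀ c d s t → Adj (member c s) (member d t) → c ~ d
members-adjacent c d s t adj =
  subst₂ _~_ (classOf-member c s) (classOf-member d t) (adjacent-classes adj)

member-apart : ∀ {c d s t} → (c , s) ≢ (d , t) → ¬ c ~ d → Apart (member c s) (member d t)
member-apart {c} {d} {s} {t} distinct ¬c~d =
    (λ same → distinct (uncurry (cong₂ _,_) (member-injective same)))
  , (λ adj → ¬c~d (members-adjacent c d s t adj))
  , (λ adj → ¬c~d (~-sym (members-adjacent d c t s adj)))

remQuot-injective : ∀ (i j : Fin (2 * 2)) → remQuot {2} 2 i ≡ remQuot {2} 2 j → i ≡ j
remQuot-injective i j same = begin
  i                                            ≡⟨ combine-remQuot {2} 2 i ⟨
  uncurry (combine {2} {2}) (remQuot {2} 2 i)  ≡⟨ cong (uncurry (combine {2} {2})) same ⟩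
  uncurry (combine {2} {2}) (remQuot {2} 2 j)  ≡⟨ combine-remQuot {2} 2 j ⟩
  j                                            ∎
  where open ≡-Reasoning

module FarClasses (c d : Fin 8) (far : ¬ Near c d) where

  pick : Fin 2 → Fin 8
  pick 0F = c
  pick 1F = d

  pick-near : ∀ w w′ → Near (pick w) (pick w′) → w ≡ w′
  pick-near 0F 0F _    = refl
  pick-near 0F 1F near = ⊥-elim (far near)
  pick-near 1F 0F near = ⊥-elim (far (Near-sym near))
  pick-near 1F 1F _    = refl

  vertex-at : Fin 2 × Fin 2 → Vertex
  vertex-at (w , s) = member (pick w) s

  vertex-at-apart : ∀ p q → p ≢ q → Apart (vertex-at p) (vertex-at q)
  vertex-at-apart (w , s) (w′ , t) p≢q = member-apart distinct not-adjacent
    where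
    distinct : (pick w , s) ≢ (pick w′ , t)
    distinct same with refl ← pick-near w w′ (inj₁ (,-injectiveˡ same)) =
      p≢q (cong (w ,_) (,-injectiveʳ same))
    not-adjacent : ¬ pick w ~ pick w′
    not-adjacent adj with refl ← pick-near w w′ (inj₂ adj) = ~-irrefl (pick w) adj

  members : Fin (2 * 2) → Vertex
  members = vertex-at ∘ remQuot {2} 2

  members-apart : ∀ i j → i ≢ j → Apart (members i) (members j)
  members-apart i j i≢j =
    vertex-at-apart (remQuot {2} 2 i) (remQuot {2} 2 j) (i≢j ∘ remQuot-injective i j)

removed? : ∀ F₁ F₂ x → Dec (Removed F₁ F₂ x)
removed? F₁ F₂ x =
  any? (x ≟V_) F₁ ⊎-dec any? (λ e → x ≟V proj₁ (proj₁ e) ⊎-dec x ≟V proj₂ (proj₁ e)) F₂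

module Survivors (F₁ : List Vertex) (F₂ : List Edge) =
  Criterion (Remaining F₁ F₂) (λ x → ¬? (removed? F₁ F₂ x))

-- With at most three deleted blocks, dead classes are pairwise near: two far
-- dead classes would contain four pairwise apart deleted vertices.
dead-classes-near : (F₁ : List Vertex) (F₂ : List Edge) →
                    length F₁ + length F₂ ≤ 3 → Survivors.DeadNear F₁ F₂
dead-classes-near F₁ F₂ few c d dead-c dead-d with Near? c d
... | yes near = near
... | no far   = contradiction (≤-trans four-blocks few) (n≮n 3)
  where
  open FarClasses c d far
  deleted : ∀ p → Removed F₁ F₂ (vertex-at p)
  deleted (0F , s) = decidable-stable (removed? F₁ F₂ _) (dead-c s)
  deleted (1F , s) = decidable-stable (removed? F₁ F₂ _) (dead-d s)
  four-blocks : 4 ≤ length F₁ + length F₂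
  four-blocks = Blocks.independent-bound F₁ F₂ members members-apart (deleted ∘ remQuot {2} 2)

lemma9 : (F₁ : List Vertex) (F₂ : List Edge) →
         length F₁ + length F₂ ≤ 3 →
         Connected (Remaining F₁ F₂)
lemma9 F₁ F₂ few = Survivors.connected F₁ F₂ (dead-classes-near F₁ F₂ few)
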